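{- Let $t$ be a PPC_dB term and $V,M$ lists of lists of distinct symbols such that $\mathcal U_{V,M}(t)$ is defined (and $\mathcal T_{V,M}$ is defined on the result). Then $\mathcal T_{V,M}(\mathcal U_{V,M}(t))=t$.
   Context: **Terms.** PPC terms: $t::=x\mid\hat x\mid t\,t\mid\lambda_\theta p.s$, with $\theta$ a list of symbols binding matchables in $p$ and variables in $s$. PPC_dB terms: $t::=\mathsf v_{i,j}\mid\mathsf m_{i,j}\mid t\,t\mid\lambda_np.s$. Equality of PPC_dB terms is modulo permutation of the secondary indices bound by the same abstraction. **Translations.** For lists of lists of symbols ($V_i$ is the $i$-th list, $V_{ij}$ its $j$-th element; $\theta++V=[\theta]++V$): Forward translation: - $\mathcal T_{V,M}(x)=\mathsf v_{i,j}$ with $i=\min\{i'\mid x\in V_{i'}\}$ and $j=\min\{j'\mid x=V_{ij'}\}$; - $\mathcal T_{V,M}(\hat x)=\mathsf m_{i,j}$, likewise using $M$; - homomorphic on applications; - $\mathcal T_{V,M}(\lambda_\theta p.s)=\lambda_{|\theta|}\mathcal T_{V,\theta++M}(p).\mathcal T_{\theta++V,M}(s)$. Backward translation: - $\mathcal U_{V,M}(\mathsf v_{i,j})=V_{ij}$ and $\mathcal U_{V,M}(\mathsf m_{i,j})=\widehat{M_{ij}}$; - homomorphic on applications; - $\mathcal U_{V,M}(\lambda_np.s)=\lambda_\theta\mathcal U_{V,\theta++M}(p).\mathcal U_{\theta++V,M}(s)$, with $\theta$ a list of $n$ fresh symbols. $\mathcal U_{V,M}(t)$ requires $V_{ij}$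 to exist for every free variable index $(i,j)$ of $t$, and $M_{ij}$ to exist for every free matchable index. -}

module Defs where

open import Data.Nat using (ℕ; zero; suc; _<?_; _≡ᵇ_)
open import Data.Bool using (if_then_else_)
open import Data.Fin using (toℕ; fromℕ<)
open import Data.Fin.Permutation using (Permutation′; _⟨$⟩ʳ_)
open import Data.List using (List; []; _∷_; length; concat)
open import Data.List.Relation.Unary.All using (All)
open import Data.List.Relation.Unary.Unique.Propositional using (Unique)
open import Data.List.Membership.Propositional using (_∉_)
open import Data.Maybe using (Maybe; just; nothing; _>>=_)
import Data.Maybe as Maybe
open import Data.Product using (Σ; _×_; _,_)
open import Relation.Nullary using (yes; no)
open import Relation.Binary.PropositionalEquality using (_≡_)

-- Symbols are natural numbers (an infinite supply, so fresh symbols exist).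
Sym : Set
Sym = ℕ

-- PPC terms: x, x̂, t t, λ_θ p . s
data PTm : Set where
  var : Sym → PTm
  mat : Sym → PTm
  app : PTm → PTm → PTm
  lam : List Sym → PTm → PTm → PTm

-- PPC_dB terms: v_{i,j}, m_{i,j}, t t, λ_n p . s
data Tm : Set where
  v   : ℕ → ℕ → Tm
  m   : ℕ → ℕ → Tm
  app : Tm → Tm → Tm
  lam : ℕ → Tm → Tm → Tm

-- Equality of PPC_dB terms modulo permutation of the secondary indices
-- bound by the same abstraction.

-- an environment of permutations, one per enclosing binder level
PEnv : Set
PEnv = List (Σ ℕ Permutation′)

act : PEnv → ℕ → ℕ → ℕ
act []             i       j = j
act ((n , σ) ∷ πs) zero    j with j <? n
... | yes j<n = toℕ (σ ⟨$⟩ʳ fromℕ< j<n)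
... | no  _   = j
act (_ ∷ πs)       (suc i) j = act πs i j

data PermEq (πV πM : PEnv) : Tm → Tm → Set where
  v-eq   : ∀ i j → PermEq πV πM (v i j) (v i (act πV i j))
  m-eq   : ∀ i j → PermEq πV πM (m i j) (m i (act πM i j))
  app-eq : ∀ {t u t' u'} → PermEq πV πM t t' → PermEq πV πM u u'
         → PermEq πV πM (app t u) (app t' u')
  lam-eq : ∀ {n p s p' s'} (σ : Permutation′ n)
         → PermEq πV ((n , σ) ∷ πM) p p'
         → PermEq ((n , σ) ∷ πV) πM s s'
         → PermEq πV πM (lam n p s) (lam n p' s')

_≈dB_ : Tm → Tm → Set
t ≈dB u = PermEq [] [] t u

pos : Sym → List Sym → Maybe ℕ
pos x []       = nothing
pos x (y ∷ ys) = if x ≡ᵇ y then just zero else Maybe.map suc (pos x ys)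

idx : Sym → List (List Sym) → Maybe (ℕ × ℕ)
idx x []       = nothing
idx x (l ∷ ls) with pos x l
... | just j  = just (zero , j)
... | nothing = Maybe.map (λ { (i , j) → (suc i , j) }) (idx x ls)

T : List (List Sym) → List (List Sym) → PTm → Maybe Tm
T V M (var x) = Maybe.map (λ { (i , j) → v i j }) (idx x V)
T V M (mat x) = Maybe.map (λ { (i , j) → m i j }) (idx x M)
T V M (app t u) = T V M t >>= λ t' → T V M u >>= λ u' → just (app t' u')
T V M (lam θ p s) =
  T V (θ ∷ M) p >>= λ p' → T (θ ∷ V) M s >>= λ s' → just (lam (length θ) p' s')

-- Backward translation U_{V,M}, as a relation (the fresh symbols θ are
-- an arbitrary choice): U V M t u  means  u is a result of U_{V,M}(t).

lookup : {A : Set} → List A → ℕ → Maybe A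
lookup []       _       = nothing
lookup (x ∷ xs) zero    = just x
lookup (x ∷ xs) (suc n) = lookup xs n

lookup2 : List (List Sym) → ℕ → ℕ → Maybe Sym
lookup2 V i j = lookup V i >>= λ Vi → lookup Vi j

Fresh : List Sym → List (List Sym) → List (List Sym) → Set
Fresh θ V M = Unique θ × All (λ x → (x ∉ concat V) × (x ∉ concat M)) θ

data U (V M : List (List Sym)) : Tm → PTm → Set where
  U-v   : ∀ {i j x} → lookup2 V i j ≡ just x → U V M (v i j) (var x)
  U-m   : ∀ {i j x} → lookup2 M i j ≡ just x → U V M (m i j) (mat x)
  U-app : ∀ {t u t' u'} → U V M t t' → U V M u u' → U V M (app t u) (app t' u')
  U-lam : ∀ {n p s p' s'} (θ : List Sym) → length θ ≡ n → Fresh θ V M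
        → U V (θ ∷ M) p p' → U (θ ∷ V) M s s'
        → U V M (lam n p s) (lam θ p' s')

-- "lists of lists of distinct symbols": all symbols occurring in V are
-- pairwise distinct
Distinct : List (List Sym) → Set
Distinct V = Unique (concat V)

module Submission where

-- The proof shows the stronger fact that the round trip is the identity
-- on the nose, T_{V,M}(U_{V,M}(t)) = t, and then weakens equality to ≈dB
-- by reflexivity of ≈dB (identity permutations at every binder).
--
-- The heart of the argument is a single property of environments: if
-- the symbols of V are pairwise distinct and U reads x = V_ij, then the
-- least index of x in V computed by T is exactly (i, j).

open import Defs
open import Data.List using (List)
open import Data.Maybe using (just)
open import Relation.Binary.PropositionalEquality using (_≡_)

open import Data.Bool using (true; false)
import Data.Bool as Bool
open import Data.Empty using (⊥-elim)
open import Data.Fin.Properties using (toℕ-fromℕ<)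
import Data.Fin.Permutation as Perm
open import Data.List using ([]; _∷_; _++_; concat)
open import Data.List.Membership.Propositional using (_∈_; _∉_)
open import Data.List.Membership.Propositional.Properties using (∈-++⁺ˡ; ∈-++⁺ʳ)
open import Data.List.Relation.Unary.All using (All; []; _∷_)
import Data.List.Relation.Unary.All as All
import Data.List.Relation.Unary.All.Properties as All
open import Data.List.Relation.Unary.AllPairs using ([]; _∷_)
open import Data.List.Relation.Unary.Any using (here; there)
open import Data.List.Relation.Unary.Unique.Propositional using (Unique)
import Data.List.Relation.Unary.Unique.Propositional.Properties as Unique
open import Data.Maybe using (nothing)
open import Data.Maybe.Properties using (just-injective)
open import Data.Nat using (suc; _<?_; _≡ᵇ_)
open import Data.Nat.Properties using (≡ᵇ⇒≡)
open import Data.Product using (_,_; proj₁; proj₂)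
open import Function using (_∘_)
open import Relation.Nullary using (yes; no)
open import Relation.Binary.PropositionalEquality
  using (refl; sym; trans; subst; _≢_; ≢-sym)

IdentityEnv : PEnv → Set
IdentityEnv π = ∀ i j → act π i j ≡ j

identityEnv-[] : IdentityEnv []
identityEnv-[] i j = refl

identityEnv-∷ : ∀ n {π} → IdentityEnv π → IdentityEnv ((n , Perm.id) ∷ π)
identityEnv-∷ n id-π 0       j with j <? n
... | yes j<n = toℕ-fromℕ< j<n
... | no  _   = refl
identityEnv-∷ n id-π (suc i) j = id-π i j

PermEq-refl : ∀ {πV πM} → IdentityEnv πV → IdentityEnv πM → ∀ t → PermEq πV πM t t
PermEq-refl {πV} {πM} id-V id-M (v i j) =
  subst (λ k → PermEq πV πM (v i j) (v i k)) (id-V i j) (v-eq i j)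
PermEq-refl {πV} {πM} id-V id-M (m i j) =
  subst (λ k → PermEq πV πM (m i j) (m i k)) (id-M i j) (m-eq i j)
PermEq-refl id-V id-M (app t u) =
  app-eq (PermEq-refl id-V id-M t) (PermEq-refl id-V id-M u)
PermEq-refl id-V id-M (lam n p s) =
  lam-eq Perm.id (PermEq-refl id-V (identityEnv-∷ n id-M) p)
                 (PermEq-refl (identityEnv-∷ n id-V) id-M s)

≈dB-refl : ∀ t → t ≈dB t
≈dB-refl = PermEq-refl identityEnv-[] identityEnv-[]

module _ {A : Set} where

  Unique-++⁻ˡ : ∀ (xs : List A) {ys} → Unique (xs ++ ys) → Unique xs
  Unique-++⁻ˡ []       _        = []
  Unique-++⁻ˡ (x ∷ xs) (x∉ ∷ u) = All.++⁻ˡ xs x∉ ∷ Unique-++⁻ˡ xs u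

  Unique-++⁻ʳ : ∀ (xs : List A) {ys} → Unique (xs ++ ys) → Unique ys
  Unique-++⁻ʳ []       u       = u
  Unique-++⁻ʳ (x ∷ xs) (_ ∷ u) = Unique-++⁻ʳ xs u

  Unique-++-disjoint : ∀ (xs : List A) {ys z} → Unique (xs ++ ys) → z ∈ ys → z ∉ xs
  Unique-++-disjoint (x ∷ xs) (x≢ ∷ _) z∈ys (here refl) =
    All.lookup (All.++⁻ʳ xs x≢) z∈ys refl
  Unique-++-disjoint (x ∷ xs) (_ ∷ u)  z∈ys (there z∈xs) =
    Unique-++-disjoint xs u z∈ys z∈xs

Distinct-∷ : ∀ {θ} V → Unique θ → All (_∉ concat V) θ → Distinct V → Distinct (θ ∷ V)
Distinct-∷ V uθ θ-avoids dV = Unique.++⁺ uθ dV (λ (z∈θ , z∈V) → All.lookup θ-avoids z∈θ z∈V)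

Distinct-∷ᵛ : ∀ {θ} V M → Fresh θ V M → Distinct V → Distinct (θ ∷ V)
Distinct-∷ᵛ V M (uθ , fresh) = Distinct-∷ V uθ (All.map proj₁ fresh)

Distinct-∷ᵐ : ∀ {θ} V M → Fresh θ V M → Distinct M → Distinct (θ ∷ M)
Distinct-∷ᵐ V M (uθ , fresh) = Distinct-∷ M uθ (All.map proj₂ fresh)

≡ᵇ-≢ : ∀ {x y} → x ≢ y → (x ≡ᵇ y) ≡ false
≡ᵇ-≢ {x} {y} x≢y with x ≡ᵇ y in eq
... | true  = ⊥-elim (x≢y (≡ᵇ⇒≡ x y (subst Bool.T (sym eq) _)))
... | false = refl

≡ᵇ-refl : ∀ x → (x ≡ᵇ x) ≡ true
≡ᵇ-refl 0       = refl
≡ᵇ-refl (suc x) = ≡ᵇ-refl x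

lookup-∈ : ∀ (l : List Sym) j {x} → lookup l j ≡ just x → x ∈ l
lookup-∈ (y ∷ l) 0       refl = here refl
lookup-∈ (y ∷ l) (suc j) eq   = there (lookup-∈ l j eq)

lookup2-∈ : ∀ (V : List (List Sym)) i j {x} → lookup2 V i j ≡ just x → x ∈ concat V
lookup2-∈ (l ∷ V) 0       j eq = ∈-++⁺ˡ (lookup-∈ l j eq)
lookup2-∈ (l ∷ V) (suc i) j eq = ∈-++⁺ʳ l (lookup2-∈ V i j eq)

pos-∉ : ∀ {x} (l : List Sym) → x ∉ l → pos x l ≡ nothing
pos-∉ []      _   = refl
pos-∉ (y ∷ l) x∉l rewrite ≡ᵇ-≢ (x∉l ∘ here) | pos-∉ l (x∉l ∘ there) = refl

pos-lookup : ∀ (l : List Sym) j {x} → Unique l → lookup l j ≡ just x → pos x l ≡ just j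
pos-lookup (y ∷ l) 0       _          refl rewrite ≡ᵇ-refl y = refl
pos-lookup (y ∷ l) (suc j) (y∉l ∷ ul) eq
  rewrite ≡ᵇ-≢ (≢-sym (All.lookup y∉l (lookup-∈ l j eq))) | pos-lookup l j ul eq = refl

idx-lookup2 : ∀ (V : List (List Sym)) i j {x}
  → Distinct V → lookup2 V i j ≡ just x → idx x V ≡ just (i , j)
idx-lookup2 (l ∷ V) 0       j dV eq
  rewrite pos-lookup l j (Unique-++⁻ˡ l dV) eq = refl
idx-lookup2 (l ∷ V) (suc i) j dV eq
  rewrite pos-∉ l (Unique-++-disjoint l dV (lookup2-∈ V i j eq))
        | idx-lookup2 V i j (Unique-++⁻ʳ l dV) eq = refl

T∘U≡id : ∀ {V M t u} → Distinct V → Distinct M → U V M t u → T V M u ≡ just t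
T∘U≡id {V} dV dM (U-v {i} {j} eq) rewrite idx-lookup2 V i j dV eq = refl
T∘U≡id {M = M} dV dM (U-m {i} {j} eq) rewrite idx-lookup2 M i j dM eq = refl
T∘U≡id dV dM (U-app Ut Uu)
  rewrite T∘U≡id dV dM Ut | T∘U≡id dV dM Uu = refl
T∘U≡id {V} {M} dV dM (U-lam θ refl fresh Up Us)
  rewrite T∘U≡id dV (Distinct-∷ᵐ V M fresh dM) Up
        | T∘U≡id (Distinct-∷ᵛ V M fresh dV) dM Us = refl

lemma4p11 : (V M : List (List Sym)) (t : Tm) (u : PTm) (t' : Tm)
    → Distinct V → Distinct M
    → U V M t u
    → T V M u ≡ just t'
    → t' ≈dB t
lemma4p11 V M t u t' dV dM Ut Tu≡t' = subst (_≈dB t) t≡t' (≈dB-refl t)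
  where
  t≡t' : t ≡ t'
  t≡t' = just-injective (trans (sym (T∘U≡id dV dM Ut)) Tu≡t')
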